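{- Let $k\ge 2$ and let $G$ be a graph admitting a closed neighborhood balanced $k$-coloring $c$ with color classes $V_1,\dots,V_k$. Then for all $i\ne j$ in $\{1,\dots,k\}$, $$|E(V_i,V_j)|=\frac{2|E(G)|+|V(G)|}{k^2},$$ and for every $i\in\{1,\dots,k\}$, $$|E(V_i,V_i)|=\frac{2|E(G)|+|V(G)|}{2k^2}-\frac{|V_i|}{2}.$$
   Context: All graphs are finite and simple. $N[v]$ is the closed neighborhood of $v$. A closed neighborhood balanced $k$-coloring of $G$ is a map $c:V(G)\to\{1,\dots,k\}$ such that for every vertex $v$ the numbers $|N[v]\cap c^{ -1}(i)|$, $i=1,\dots,k$, are all equal; its color classes are $V_i=c^{ -1}(i)$. For $X,Y\subseteq V(G)$, $E(X,Y)$ denotes the set of edges with one endpoint in $X$ and the other in $Y$; in particular $E(X,X)$ is the set of edges with both endpoints in $X$. -}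

module Defs where

open import Data.Nat using (ℕ; _<_; _≤_)
open import Data.Fin using (Fin; toℕ; _<?_)
open import Data.Bool using (Bool; true; false; T; T?; _∧_; _∨_)
open import Data.List using (List; length; filter; allFin; map)
open import Data.Nat.ListAction using (sum)
open import Data.Fin.Properties using (_≟_)
open import Relation.Binary.PropositionalEquality using (_≡_)
open import Relation.Nullary using (¬_)
open import Relation.Nullary.Decidable using (⌊_⌋)

record Graph (n : ℕ) : Set where
  field
    adj   : Fin n → Fin n → Bool
    sym   : ∀ u v → adj u v ≡ adj v u
    irrefl : ∀ v → adj v v ≡ false

open Graph public

countF : ∀ {n} → (Fin n → Bool) → ℕ
countF {n} p = length (filter (λ x → T? (p x)) (allFin n))

countPairs : ∀ {n} → (Fin n → Fin n → Bool) → ℕ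
countPairs {n} p = sum (map (λ u → countF (λ v → ⌊ u <? v ⌋ ∧ p u v)) (allFin n))

inN : ∀ {n} → Graph n → Fin n → Fin n → Bool
inN G v w = ⌊ v ≟ w ⌋ ∨ adj G v w

hasColour : ∀ {n k} → (Fin n → Fin k) → Fin k → Fin n → Bool
hasColour c i w = ⌊ c w ≟ i ⌋

nbhdColourCount : ∀ {n k} → Graph n → (Fin n → Fin k) → Fin n → Fin k → ℕ
nbhdColourCount G c v i = countF (λ w → inN G v w ∧ hasColour c i w)

IsCNBColouring : ∀ {n} (k : ℕ) → Graph n → (Fin n → Fin k) → Set
IsCNBColouring k G c = ∀ v i j → nbhdColourCount G c v i ≡ nbhdColourCount G c v j

numEdges : ∀ {n} → Graph n → ℕ
numEdges G = countPairs (adj G)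

classSize : ∀ {n k} → (Fin n → Fin k) → Fin k → ℕ
classSize c i = countF (hasColour c i)

-- |E(V_i, V_j)|: edges with one endpoint in V_i and the other in V_j
-- (for i = j this is the number of edges with both endpoints in V_i)
edgesBetween : ∀ {n k} → Graph n → (Fin n → Fin k) → Fin k → Fin k → ℕ
edgesBetween G c i j = countPairs (λ u v → adj G u v ∧
  ((hasColour c i u ∧ hasColour c j v) ∨ (hasColour c j u ∧ hasColour c i v)))

-- Write m(v, i) = |N[v] ∩ V_i| and let a(X, Y) count the ordered adjacent pairs (u, v) with
-- u ∈ X, v ∈ Y, so that a(V_i, V_j) = |E(V_i, V_j)| for i ≠ j and a(V_i, V_i) = 2|E(V_i, V_i)|.
-- Double counting the pairs (v, w) with v ∈ V_j and w ∈ N[v] ∩ V_i gives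
--   Σ_{v ∈ V_j} m(v, i) = [i = j] |V_i| + a(V_j, V_i).
-- Balance makes the left-hand side a quantity L_j independent of i; for i ≠ j the identity gives
-- L_i = a(V_i, V_j) = a(V_j, V_i) = L_j, so L does not depend on the class either. Balance also
-- gives k m(v, i) = |N[v]| = 1 + deg v, hence k (k L) = k Σ_j L_j = Σ_v k m(v, c v) = |V| + 2|E|.

module Submission where

open import Defs hiding (sym)
open import Data.Nat using (ℕ; zero; suc; _+_; _*_; _≤_)
open import Data.Nat.Properties using (+-*-semiring; +-identityʳ; *-identityʳ; *-assoc; +-comm; *-comm; *-cancelˡ-≡)
open import Data.Nat.Tactic.RingSolver using (solve-∀)
import Data.Nat.ListAction as ListAction
open import Algebra.Properties.Semiring.Sum +-*-semiring
  using (sum; sum-syntax; sum-cong-≗; sum-replicate-zero; ∑-distrib-+; ∑-comm; *-distribˡ-sum)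
open import Data.Fin using (Fin; zero; suc; _<?_)
open import Data.Fin.Properties using (_≟_; <-cmp)
open import Data.Bool using (Bool; true; false; _∧_; _∨_; T?)
open import Data.Bool.Properties using (∧-idem; ∨-idem; ∨-comm; ∧-comm)
open import Data.List using (List; []; _∷_; length; filter; map; allFin; tabulate)
open import Data.List.Properties using (map-tabulate)
open import Data.Product using (_×_; _,_)
open import Function using (_∘_; id)
open import Relation.Binary.Definitions using (tri<; tri≈; tri>)
open import Relation.Binary.PropositionalEquality
open import Relation.Nullary using (¬_; Dec; yes; no; contradiction)
open import Relation.Nullary.Decidable using (⌊_⌋; isYes≗does; dec-true; dec-false)

𝟙 : Bool → ℕ
𝟙 true  = 1
𝟙 false = 0

𝟙-∧ : ∀ x y → 𝟙 (x ∧ y) ≡ 𝟙 x * 𝟙 y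
𝟙-∧ true  true  = refl
𝟙-∧ true  false = refl
𝟙-∧ false y     = refl

𝟙-∨ : ∀ x y → x ∧ y ≡ false → 𝟙 (x ∨ y) ≡ 𝟙 x + 𝟙 y
𝟙-∨ true  true  ()
𝟙-∨ true  false _ = refl
𝟙-∨ false y     _ = refl

𝟙-∨-∧ : ∀ x y z w → x ∧ z ≡ false → 𝟙 (x ∧ y ∨ z ∧ w) ≡ 𝟙 x * 𝟙 y + 𝟙 z * 𝟙 w
𝟙-∨-∧ true  y     true  w ()
𝟙-∨-∧ true  true  false w _ = refl
𝟙-∨-∧ true  false false w _ = refl
𝟙-∨-∧ false y     z     w _ = 𝟙-∧ z w

isYes-true : ∀ {A : Set} (a? : Dec A) → A → ⌊ a? ⌋ ≡ true
isYes-true a? a = trans (isYes≗does a?) (dec-true a? a)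

isYes-false : ∀ {A : Set} (a? : Dec A) → ¬ A → ⌊ a? ⌋ ≡ false
isYes-false a? ¬a = trans (isYes≗does a?) (dec-false a? ¬a)

∑-const : ∀ n x → ∑[ i < n ] x ≡ n * x
∑-const zero    x = refl
∑-const (suc n) x = cong (x +_) (∑-const n x)

δ : ∀ {n} → Fin n → Fin n → ℕ
δ v w = 𝟙 ⌊ v ≟ w ⌋

δ-suc : ∀ {n} (v w : Fin n) → δ (suc v) (suc w) ≡ δ v w
δ-suc v w with v ≟ w
... | yes _ = refl
... | no  _ = refl

∑-δ : ∀ {n} (v : Fin n) (f : Fin n → ℕ) → ∑[ w < n ] (δ v w * f w) ≡ f v
∑-δ {suc n} zero    f = trans (cong₂ _+_ (+-identityʳ (f zero)) (sum-replicate-zero n)) (+-identityʳ (f zero))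
∑-δ {suc n} (suc v) f = trans (sum-cong-≗ (λ w → cong (_* f (suc w)) (δ-suc v w))) (∑-δ v (f ∘ suc))

sum-tabulate : ∀ {n} (f : Fin n → ℕ) → ListAction.sum (tabulate f) ≡ ∑[ i < n ] f i
sum-tabulate {zero}  f = refl
sum-tabulate {suc n} f = cong (f zero +_) (sum-tabulate (f ∘ suc))

sum-map-allFin : ∀ {n} (f : Fin n → ℕ) → ListAction.sum (map f (allFin n)) ≡ ∑[ i < n ] f i
sum-map-allFin f = trans (cong ListAction.sum (map-tabulate id f)) (sum-tabulate f)

length-filter : ∀ {A : Set} (p : A → Bool) (xs : List A) →
  length (filter (T? ∘ p) xs) ≡ ListAction.sum (map (𝟙 ∘ p) xs)
length-filter p []       = refl
length-filter p (x ∷ xs) with p x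
... | true  = cong suc (length-filter p xs)
... | false = length-filter p xs

countF≡∑ : ∀ {n} (p : Fin n → Bool) → countF p ≡ ∑[ x < n ] 𝟙 (p x)
countF≡∑ {n} p = trans (length-filter p (allFin n)) (sum-map-allFin (𝟙 ∘ p))

module _ {n} (p : Fin n → Fin n → Bool)
         (p-sym : ∀ u v → p u v ≡ p v u) (p-irrefl : ∀ u → p u u ≡ false) where

  private
    ordered : Fin n → Fin n → ℕ
    ordered u v = 𝟙 (⌊ u <? v ⌋ ∧ p u v)

  𝟙-split-by-order : ∀ u v → 𝟙 (p u v) ≡ ordered u v + ordered v u
  𝟙-split-by-order u v with <-cmp u v
  ... | tri< u<v _ v≮u rewrite isYes-true (u <? v) u<v | isYes-false (v <? u) v≮u = sym (+-identityʳ _)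
  ... | tri≈ u≮u refl _ rewrite isYes-false (u <? u) u≮u | p-irrefl u = refl
  ... | tri> u≮v _ v<u rewrite isYes-false (u <? v) u≮v | isYes-true (v <? u) v<u | p-sym u v = refl

  2*countPairs≡∑∑ : 2 * countPairs p ≡ ∑[ u < n ] ∑[ v < n ] 𝟙 (p u v)
  2*countPairs≡∑∑ = begin
      2 * countPairs p
    ≡⟨ cong (2 *_) countPairs≡T ⟩
      T + (T + 0)
    ≡⟨ cong (T +_) (+-identityʳ T) ⟩
      T + T
    ≡⟨ cong (T +_) (∑-comm (λ u v → ordered v u)) ⟨
      T + ∑[ u < n ] ∑[ v < n ] ordered v u
    ≡⟨ ∑-distrib-+ (λ u → ∑[ v < n ] ordered u v) (λ u → ∑[ v < n ] ordered v u) ⟨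
      ∑[ u < n ] (∑[ v < n ] ordered u v + ∑[ v < n ] ordered v u)
    ≡⟨ sum-cong-≗ (λ u → ∑-distrib-+ (ordered u) (λ v → ordered v u)) ⟨
      ∑[ u < n ] ∑[ v < n ] (ordered u v + ordered v u)
    ≡⟨ sum-cong-≗ (λ u → sum-cong-≗ (𝟙-split-by-order u)) ⟨
      ∑[ u < n ] ∑[ v < n ] 𝟙 (p u v) ∎
    where
    open ≡-Reasoning
    T = ∑[ u < n ] ∑[ v < n ] ordered u v
    countPairs≡T : countPairs p ≡ T
    countPairs≡T = trans (sum-map-allFin (λ u → countF (λ v → ⌊ u <? v ⌋ ∧ p u v)))
                         (sum-cong-≗ λ u → countF≡∑ (λ v → ⌊ u <? v ⌋ ∧ p u v))

module Counting {n k} (G : Graph n) (c : Fin n → Fin k) where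

  a : Fin n → Fin n → ℕ
  a u v = 𝟙 (adj G u v)

  deg : Fin n → ℕ
  deg v = ∑[ w < n ] a v w

  -- χ i v is definitionally δ (c v) i, so a sum over colours weighted by χ · v collapses by ∑-δ.
  χ : Fin k → Fin n → ℕ
  χ i v = 𝟙 (hasColour c i v)

  arcs : Fin k → Fin k → ℕ
  arcs i j = ∑[ u < n ] ∑[ v < n ] (χ i u * a u v * χ j v)

  m : Fin n → Fin k → ℕ
  m = nbhdColourCount G c

  classNbhdCount : Fin k → Fin k → ℕ
  classNbhdCount j i = ∑[ v < n ] (χ j v * m v i)

  handshake : 2 * numEdges G ≡ ∑[ v < n ] deg v
  handshake = 2*countPairs≡∑∑ (adj G) (Graph.sym G) (irrefl G)

  a-sym : ∀ u v → a u v ≡ a v u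
  a-sym u v = cong 𝟙 (Graph.sym G u v)

  arcs-comm : ∀ i j → arcs i j ≡ arcs j i
  arcs-comm i j = trans (∑-comm (λ u v → χ i u * a u v * χ j v))
                        (sum-cong-≗ λ u → sum-cong-≗ λ v → reorder u v)
    where
    reorder : ∀ u v → χ i v * a v u * χ j u ≡ χ j u * a u v * χ i v
    reorder u v = trans (cong (λ t → χ i v * t * χ j u) (a-sym v u)) (xyz≡zyx (χ i v) (a u v) (χ j u))
      where
      xyz≡zyx : ∀ x y z → x * y * z ≡ z * y * x
      xyz≡zyx = solve-∀

  colours-disjoint : ∀ {i j} → i ≢ j → ∀ v → hasColour c i v ∧ hasColour c j v ≡ false
  colours-disjoint {i} {j} i≢j v with c v ≟ i | c v ≟ j
  ... | yes refl | yes refl = contradiction refl i≢j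
  ... | yes _    | no _     = refl
  ... | no _     | _        = refl

  ∑χ*χ-≢ : ∀ {i j} → i ≢ j → ∑[ v < n ] (χ j v * χ i v) ≡ 0
  ∑χ*χ-≢ {i} {j} i≢j = trans (sum-cong-≗ λ v → trans (sym (𝟙-∧ (hasColour c j v) (hasColour c i v)))
    (cong 𝟙 (colours-disjoint (i≢j ∘ sym) v))) (sum-replicate-zero n)

  ∑χ*χ : ∀ i → ∑[ v < n ] (χ i v * χ i v) ≡ classSize c i
  ∑χ*χ i = trans (sum-cong-≗ λ v → trans (sym (𝟙-∧ (hasColour c i v) _)) (cong 𝟙 (∧-idem (hasColour c i v))))
                 (sym (countF≡∑ (hasColour c i)))

  closedNbhd-split : ∀ v w → 𝟙 (inN G v w) ≡ δ v w + a v w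
  closedNbhd-split v w = 𝟙-∨ ⌊ v ≟ w ⌋ (adj G v w) loopless
    where
    loopless : ⌊ v ≟ w ⌋ ∧ adj G v w ≡ false
    loopless with v ≟ w
    ... | yes refl = irrefl G v
    ... | no  _    = refl

  closedNbhdSize : ∀ v → ∑[ w < n ] 𝟙 (inN G v w) ≡ 1 + deg v
  closedNbhdSize v = begin
      ∑[ w < n ] 𝟙 (inN G v w)
    ≡⟨ sum-cong-≗ (closedNbhd-split v) ⟩
      ∑[ w < n ] (δ v w + a v w)
    ≡⟨ ∑-distrib-+ (δ v) (a v) ⟩
      ∑[ w < n ] δ v w + deg v
    ≡⟨ cong (_+ deg v) (trans (sum-cong-≗ (λ w → sym (*-identityʳ (δ v w)))) (∑-δ v (λ _ → 1))) ⟩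
      1 + deg v ∎
    where open ≡-Reasoning

  m≡∑ : ∀ v i → m v i ≡ ∑[ w < n ] (𝟙 (inN G v w) * χ i w)
  m≡∑ v i = trans (countF≡∑ (λ w → inN G v w ∧ hasColour c i w))
                  (sum-cong-≗ λ w → 𝟙-∧ (inN G v w) (hasColour c i w))

  ∑-colours-m : ∀ v → ∑[ i < k ] m v i ≡ ∑[ w < n ] 𝟙 (inN G v w)
  ∑-colours-m v = begin
      ∑[ i < k ] m v i
    ≡⟨ sum-cong-≗ (m≡∑ v) ⟩
      ∑[ i < k ] ∑[ w < n ] (𝟙 (inN G v w) * χ i w)
    ≡⟨ ∑-comm (λ i w → 𝟙 (inN G v w) * χ i w) ⟩
      ∑[ w < n ] ∑[ i < k ] (𝟙 (inN G v w) * χ i w)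
    ≡⟨ sum-cong-≗ (λ w → trans (sum-cong-≗ λ i → *-comm (𝟙 (inN G v w)) (χ i w))
                               (∑-δ (c w) (λ _ → 𝟙 (inN G v w)))) ⟩
      ∑[ w < n ] 𝟙 (inN G v w) ∎
    where open ≡-Reasoning

  classNbhdCount≡ : ∀ j i → classNbhdCount j i ≡ ∑[ v < n ] (χ j v * χ i v) + arcs j i
  classNbhdCount≡ j i = begin
      ∑[ v < n ] (χ j v * m v i)
    ≡⟨ sum-cong-≗ (λ v → cong (χ j v *_) (trans (m≡∑ v i) (sum-cong-≗ λ w →
         cong (_* χ i w) (closedNbhd-split v w)))) ⟩
      ∑[ v < n ] (χ j v * ∑[ w < n ] ((δ v w + a v w) * χ i w))
    ≡⟨ sum-cong-≗ (λ v → trans (*-distribˡ-sum (χ j v) (λ w → (δ v w + a v w) * χ i w))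
         (trans (sum-cong-≗ λ w → distrib (χ j v) (δ v w) (a v w) (χ i w))
                (∑-distrib-+ (λ w → δ v w * (χ j v * χ i w)) (λ w → χ j v * a v w * χ i w)))) ⟩
      ∑[ v < n ] (∑[ w < n ] (δ v w * (χ j v * χ i w)) + ∑[ w < n ] (χ j v * a v w * χ i w))
    ≡⟨ ∑-distrib-+ (λ v → ∑[ w < n ] (δ v w * (χ j v * χ i w))) (λ v → ∑[ w < n ] (χ j v * a v w * χ i w)) ⟩
      ∑[ v < n ] ∑[ w < n ] (δ v w * (χ j v * χ i w)) + arcs j i
    ≡⟨ cong (_+ arcs j i) (sum-cong-≗ λ v → ∑-δ v (λ w → χ j v * χ i w)) ⟩
      ∑[ v < n ] (χ j v * χ i v) + arcs j i ∎
    where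
    open ≡-Reasoning
    distrib : ∀ x d e y → x * ((d + e) * y) ≡ d * (x * y) + x * e * y
    distrib = solve-∀

  edge : Fin k → Fin k → Fin n → Fin n → Bool
  edge i j u v = adj G u v ∧ (hasColour c i u ∧ hasColour c j v ∨ hasColour c j u ∧ hasColour c i v)

  2*edgesBetween≡∑∑ : ∀ i j → 2 * edgesBetween G c i j ≡ ∑[ u < n ] ∑[ v < n ] 𝟙 (edge i j u v)
  2*edgesBetween≡∑∑ i j = 2*countPairs≡∑∑ (edge i j) edge-sym edge-irrefl
    where
    edge-sym : ∀ u v → edge i j u v ≡ edge i j v u
    edge-sym u v = cong₂ _∧_ (Graph.sym G u v) (trans (∨-comm (hasColour c i u ∧ hasColour c j v) _)
      (cong₂ _∨_ (∧-comm (hasColour c j u) _) (∧-comm (hasColour c i u) _)))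
    edge-irrefl : ∀ u → edge i j u u ≡ false
    edge-irrefl u rewrite irrefl G u = refl

  2*edgesBetween≡arcs : ∀ {i j} → i ≢ j → 2 * edgesBetween G c i j ≡ arcs i j + arcs j i
  2*edgesBetween≡arcs {i} {j} i≢j = begin
      2 * edgesBetween G c i j
    ≡⟨ 2*edgesBetween≡∑∑ i j ⟩
      ∑[ u < n ] ∑[ v < n ] 𝟙 (edge i j u v)
    ≡⟨ sum-cong-≗ (λ u → sum-cong-≗ (λ v → 𝟙-edge u v)) ⟩
      ∑[ u < n ] ∑[ v < n ] (χ i u * a u v * χ j v + χ j u * a u v * χ i v)
    ≡⟨ sum-cong-≗ (λ u → ∑-distrib-+ (λ v → χ i u * a u v * χ j v) (λ v → χ j u * a u v * χ i v)) ⟩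
      ∑[ u < n ] (∑[ v < n ] (χ i u * a u v * χ j v) + ∑[ v < n ] (χ j u * a u v * χ i v))
    ≡⟨ ∑-distrib-+ (λ u → ∑[ v < n ] (χ i u * a u v * χ j v)) (λ u → ∑[ v < n ] (χ j u * a u v * χ i v)) ⟩
      arcs i j + arcs j i ∎
    where
    open ≡-Reasoning
    distrib : ∀ e x y z w → e * (x * y + z * w) ≡ x * e * y + z * e * w
    distrib = solve-∀
    𝟙-edge : ∀ u v → 𝟙 (edge i j u v) ≡ χ i u * a u v * χ j v + χ j u * a u v * χ i v
    𝟙-edge u v = begin
        𝟙 (edge i j u v)
      ≡⟨ 𝟙-∧ (adj G u v) _ ⟩
        a u v * 𝟙 (hasColour c i u ∧ hasColour c j v ∨ hasColour c j u ∧ hasColour c i v)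
      ≡⟨ cong (a u v *_) (𝟙-∨-∧ (hasColour c i u) _ (hasColour c j u) _ (colours-disjoint i≢j u)) ⟩
        a u v * (χ i u * χ j v + χ j u * χ i v)
      ≡⟨ distrib (a u v) (χ i u) (χ j v) (χ j u) (χ i v) ⟩
        χ i u * a u v * χ j v + χ j u * a u v * χ i v ∎

  2*edgesWithin≡arcs : ∀ i → 2 * edgesBetween G c i i ≡ arcs i i
  2*edgesWithin≡arcs i = trans (2*edgesBetween≡∑∑ i i) (sum-cong-≗ λ u → sum-cong-≗ λ v → 𝟙-edge u v)
    where
    reorder : ∀ e x y → e * (x * y) ≡ x * e * y
    reorder = solve-∀
    𝟙-edge : ∀ u v → 𝟙 (edge i i u v) ≡ χ i u * a u v * χ i v
    𝟙-edge u v rewrite ∨-idem (hasColour c i u ∧ hasColour c i v)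
                     | 𝟙-∧ (adj G u v) (hasColour c i u ∧ hasColour c i v)
                     | 𝟙-∧ (hasColour c i u) (hasColour c i v) = reorder (a u v) (χ i u) (χ i v)

  edgesBetween≡arcs : ∀ {i j} → i ≢ j → edgesBetween G c i j ≡ arcs i j
  edgesBetween≡arcs {i} {j} i≢j = *-cancelˡ-≡ _ _ 2 (begin
      2 * edgesBetween G c i j  ≡⟨ 2*edgesBetween≡arcs i≢j ⟩
      arcs i j + arcs j i       ≡⟨ cong (arcs i j +_) (trans (arcs-comm j i) (sym (+-identityʳ _))) ⟩
      2 * arcs i j              ∎)
    where open ≡-Reasoning

  classNbhdCount-≢ : ∀ {i j} → i ≢ j → classNbhdCount j i ≡ edgesBetween G c i j
  classNbhdCount-≢ {i} {j} i≢j = begin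
      classNbhdCount j i                     ≡⟨ classNbhdCount≡ j i ⟩
      ∑[ v < n ] (χ j v * χ i v) + arcs j i  ≡⟨ cong (_+ arcs j i) (∑χ*χ-≢ i≢j) ⟩
      arcs j i                               ≡⟨ arcs-comm j i ⟩
      arcs i j                               ≡⟨ edgesBetween≡arcs i≢j ⟨
      edgesBetween G c i j                   ∎
    where open ≡-Reasoning

  classNbhdCount-refl : ∀ i → classNbhdCount i i ≡ classSize c i + 2 * edgesBetween G c i i
  classNbhdCount-refl i = trans (classNbhdCount≡ i i) (cong₂ _+_ (∑χ*χ i) (sym (2*edgesWithin≡arcs i)))

module Balanced {n k} (G : Graph n) (c : Fin n → Fin k) (balanced : IsCNBColouring k G c) where
  open Counting G c

  load : Fin k → ℕ
  load j = classNbhdCount j j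

  classNbhdCount≡load : ∀ j i → classNbhdCount j i ≡ load j
  classNbhdCount≡load j i = sum-cong-≗ λ v → cong (χ j v *_) (balanced v i j)

  edgesBetween≡load : ∀ {i j} → i ≢ j → edgesBetween G c i j ≡ load j
  edgesBetween≡load {i} {j} i≢j = trans (sym (classNbhdCount-≢ i≢j)) (classNbhdCount≡load j i)

  load-const : ∀ i j → load i ≡ load j
  load-const i j with i ≟ j
  ... | yes refl = refl
  ... | no  i≢j  = trans (sym (edgesBetween≡load (i≢j ∘ sym))) (trans edges-comm (edgesBetween≡load i≢j))
    where
    edges-comm : edgesBetween G c j i ≡ edgesBetween G c i j
    edges-comm = trans (edgesBetween≡arcs (i≢j ∘ sym)) (trans (arcs-comm j i) (sym (edgesBetween≡arcs i≢j)))

  k*m≡closedNbhdSize : ∀ v i → k * m v i ≡ 1 + deg v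
  k*m≡closedNbhdSize v i = begin
      k * m v i                  ≡⟨ ∑-const k (m v i) ⟨
      ∑[ j < k ] m v i           ≡⟨ sum-cong-≗ (λ j → balanced v i j) ⟩
      ∑[ j < k ] m v j           ≡⟨ ∑-colours-m v ⟩
      ∑[ w < n ] 𝟙 (inN G v w)   ≡⟨ closedNbhdSize v ⟩
      1 + deg v                  ∎
    where open ≡-Reasoning

  k*k*load : ∀ i → k * (k * load i) ≡ 2 * numEdges G + n
  k*k*load i = begin
      k * (k * load i)
    ≡⟨ cong (k *_) (trans (sum-cong-≗ λ j → load-const j i) (∑-const k (load i))) ⟨
      k * ∑[ j < k ] load j
    ≡⟨ cong (k *_) (∑-comm (λ j v → χ j v * m v j)) ⟩
      k * ∑[ v < n ] ∑[ j < k ] (χ j v * m v j)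
    ≡⟨ cong (k *_) (sum-cong-≗ λ v → ∑-δ (c v) (m v)) ⟩
      k * ∑[ v < n ] m v (c v)
    ≡⟨ *-distribˡ-sum k (λ v → m v (c v)) ⟩
      ∑[ v < n ] (k * m v (c v))
    ≡⟨ sum-cong-≗ (λ v → k*m≡closedNbhdSize v (c v)) ⟩
      ∑[ v < n ] (1 + deg v)
    ≡⟨ ∑-distrib-+ (λ _ → 1) deg ⟩
      ∑[ v < n ] 1 + ∑[ v < n ] deg v
    ≡⟨ cong₂ _+_ (trans (∑-const n 1) (*-identityʳ n)) (sym handshake) ⟩
      n + 2 * numEdges G
    ≡⟨ +-comm n _ ⟩
      2 * numEdges G + n ∎
    where open ≡-Reasoning

theorem2p8 : (k : ℕ) → 2 ≤ k → (n : ℕ) → (G : Graph n) → (c : Fin n → Fin k) →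
    IsCNBColouring k G c →
    ((i j : Fin k) → i ≢ j → k * k * edgesBetween G c i j ≡ 2 * numEdges G + n)
    × ((i : Fin k) → 2 * (k * k) * edgesBetween G c i i + k * k * classSize c i ≡ 2 * numEdges G + n)
theorem2p8 k _ n G c balanced = between , within
  where
  open Counting G c
  open Balanced G c balanced
  between : (i j : Fin k) → i ≢ j → k * k * edgesBetween G c i j ≡ 2 * numEdges G + n
  between i j i≢j = trans (cong (k * k *_) (edgesBetween≡load i≢j)) (trans (*-assoc k k _) (k*k*load j))
  rearrange : ∀ q e s → 2 * (q * q) * e + q * q * s ≡ q * (q * (s + 2 * e))
  rearrange = solve-∀
  within : (i : Fin k) → 2 * (k * k) * edgesBetween G c i i + k * k * classSize c i ≡ 2 * numEdges G + n
  within i = trans (rearrange k _ _) (trans (cong (λ x → k * (k * x)) (sym (classNbhdCount-refl i))) (k*k*load i))
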